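{- ${\sf bleaf}\equiv_{\rm sW} 0$; that is, ${\sf bleaf}$ lies at the lowest level of the strong Weihrauch hierarchy: there is a single computable functional which, given any tree $T$ together with any bounding function $b$ for $T$, outputs (the characteristic function of) $\mathrm{leaf}(T)$.
   Context: A tree is a set $T$ of finite sequences of natural numbers closed under initial subsequences; $\mathrm{lh}(\sigma)$ is the length of $\sigma$. A leaf of $T$ is a sequence in $T$ with no proper extension in $T$, and $\mathrm{leaf}(T)$ is the set of leaves. A function $b:\mathbb N\to\mathbb N$ is a bounding function for $T$ if $\sigma(i)\le b(i)$ for all $\sigma\in T$ and $i<\mathrm{lh}(\sigma)$. ${\sf bleaf}$ is the Weihrauch problem whose inputs are pairs $(T,b)$ with $b$ a bounding function for the tree $T$, and whose output is $\mathrm{leaf}(T)$. Here $0$ denotes the lowest degree of the strong Weihrauch hierarchy (problems solvable by a computable functional). -}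

module Defs where

open import Data.Nat using (ℕ; _≤_)
open import Data.Bool using (Bool; true)
open import Data.List using (List; []; _∷_; _++_; length; lookup)
open import Data.Fin using (toℕ)
open import Data.Product using (_×_; ∃; Σ)
open import Relation.Binary.PropositionalEquality using (_≡_; _≢_)
open import Relation.Nullary using (¬_)
open import Function.Bundles using (_⇔_)

Seq : Set
Seq = List ℕ

-- A set of finite sequences, given by its characteristic function
-- (the represented input of the Weihrauch problem).
SeqSet : Set
SeqSet = Seq → Bool

_∈T_ : Seq → SeqSet → Set
σ ∈T T = T σ ≡ true

IsTree : SeqSet → Set
IsTree T = ∀ (σ τ : Seq) → (σ ++ τ) ∈T T → σ ∈T T

IsBounding : SeqSet → (ℕ → ℕ) → Set
IsBounding T b = ∀ (σ : Seq) → σ ∈T T → ∀ i → lookup σ i ≤ b (toℕ i)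

IsLeaf : SeqSet → Seq → Set
IsLeaf T σ = σ ∈T T × (∀ (τ : Seq) → τ ≢ [] → ¬ ((σ ++ τ) ∈T T))

IsLeafSet : SeqSet → SeqSet → Set
IsLeafSet T f = ∀ (σ : Seq) → (f σ ≡ true) ⇔ IsLeaf T σ

module Submission where

-- Given a tree T and a bounding function b, a sequence σ is a leaf of T
-- exactly when σ ∈ T and no one-step extension σ ++ [k] lies in T.  The
-- bound b makes the second condition decidable: every child σ ++ [k] of a
-- node of T satisfies k ≤ b (length σ), so it suffices to inspect the
-- finitely many candidates k = 0, …, b (length σ).
--
-- Together these characterise leaves by the Boolean test
--   leafTest T b σ = T σ ∧ not (hasChild T b σ),
-- which is the required computable functional.

open import Defs
open import Data.Nat using (ℕ; zero; suc; _≤_; z≤n; s≤s)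
open import Data.Nat.Properties using (m≤n⇒m<n∨m≡n)
open import Data.Bool using (Bool; true; false; _∧_; _∨_; not)
open import Data.Bool.Properties using (∨-zeroˡ; ∨-zeroʳ)
open import Data.List using ([]; _∷_; _++_; length; lookup)
open import Data.List.Properties using (++-assoc)
open import Data.Fin using (Fin; toℕ)
open import Data.Product using (Σ; ∃; _×_; _,_)
open import Data.Sum using (inj₁; inj₂)
open import Function.Bundles using (_⇔_; mk⇔)
import Function.Properties.Equivalence as ⇔
open import Relation.Binary.PropositionalEquality
  using (_≡_; _≢_; refl; sym; trans; cong; subst; subst₂)
open import Relation.Nullary using (¬_)

anyUpTo : (ℕ → Bool) → ℕ → Bool
anyUpTo p zero    = p zero
anyUpTo p (suc n) = p (suc n) ∨ anyUpTo p n

anyUpTo-sound : ∀ p n → anyUpTo p n ≡ true → ∃ λ (k : ℕ) → p k ≡ true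
anyUpTo-sound p zero    found = zero , found
anyUpTo-sound p (suc n) found with p (suc n) in pn
... | true  = suc n , pn
... | false = anyUpTo-sound p n found

anyUpTo-complete : ∀ p n {k} → k ≤ n → p k ≡ true → anyUpTo p n ≡ true
anyUpTo-complete p zero    z≤n pk = pk
anyUpTo-complete p (suc n) k≤n pk with m≤n⇒m<n∨m≡n k≤n
... | inj₁ (s≤s k≤n′) =
  trans (cong (p (suc n) ∨_) (anyUpTo-complete p n k≤n′ pk)) (∨-zeroʳ _)
... | inj₂ refl = trans (cong (_∨ anyUpTo p n) pk) (∨-zeroˡ (anyUpTo p n))

last-index : ∀ (σ : Seq) (k : ℕ) → Σ (Fin (length (σ ++ k ∷ []))) λ i →
             lookup (σ ++ k ∷ []) i ≡ k × toℕ i ≡ length σ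
last-index []      k = Fin.zero , refl , refl
last-index (x ∷ σ) k with last-index σ k
... | i , at-i , i≡ = Fin.suc i , at-i , cong suc i≡

child-of-extension : ∀ T → IsTree T → ∀ σ (k : ℕ) τ →
                     (σ ++ k ∷ τ) ∈T T → (σ ++ k ∷ []) ∈T T
child-of-extension T tree σ k τ ext∈T =
  tree (σ ++ k ∷ []) τ (subst (λ s → T s ≡ true) (sym (++-assoc σ (k ∷ []) τ)) ext∈T)

child-bounded : ∀ T b → IsBounding T b → ∀ σ (k : ℕ) →
                (σ ++ k ∷ []) ∈T T → k ≤ b (length σ)
child-bounded T b bounding σ k child∈T with last-index σ k
... | i , at-i , i≡ = subst₂ _≤_ at-i (cong b i≡) (bounding (σ ++ k ∷ []) child∈T i)

hasChild : SeqSet → (ℕ → ℕ) → Seq → Bool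
hasChild T b σ = anyUpTo (λ k → T (σ ++ k ∷ [])) (b (length σ))

leafTest : SeqSet → (ℕ → ℕ) → SeqSet
leafTest T b σ = T σ ∧ not (hasChild T b σ)

leaf⇔childless : ∀ T b → IsTree T → IsBounding T b → ∀ σ →
                 IsLeaf T σ ⇔ (σ ∈T T × hasChild T b σ ≡ false)
leaf⇔childless T b tree bounding σ = mk⇔ childless leaf
  where
  childless : IsLeaf T σ → σ ∈T T × hasChild T b σ ≡ false
  childless (σ∈T , noExt) with hasChild T b σ in search
  ... | false = σ∈T , refl
  ... | true with anyUpTo-sound _ (b (length σ)) search
  ...   | k , child∈T with noExt (k ∷ []) (λ ()) child∈T
  ...     | ()

  leaf : σ ∈T T × hasChild T b σ ≡ false → IsLeaf T σ
  leaf (σ∈T , noChild) = σ∈T , noExt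
    where
    noExt : ∀ τ → τ ≢ [] → ¬ ((σ ++ τ) ∈T T)
    noExt []      nonEmpty _     = nonEmpty refl
    noExt (k ∷ τ) _        ext∈T
      with trans (sym noChild) (anyUpTo-complete _ (b (length σ))
                 (child-bounded T b bounding σ k child∈T) child∈T)
      where child∈T = child-of-extension T tree σ k τ ext∈T
    ... | ()

∧-not-true : ∀ x y → (x ∧ not y ≡ true) ⇔ (x ≡ true × y ≡ false)
∧-not-true true  false = mk⇔ (λ _ → refl , refl) (λ _ → refl)
∧-not-true true  true  = mk⇔ (λ ()) (λ ())
∧-not-true false y     = mk⇔ (λ ()) (λ ())

proposition2 : Σ (SeqSet → (ℕ → ℕ) → SeqSet) λ F → ∀ (T : SeqSet) (b : ℕ → ℕ) → IsTree T → IsBounding T b → IsLeafSet T (F T b)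
proposition2 = leafTest , λ T b tree bounding σ →
  ⇔.trans (∧-not-true (T σ) (hasChild T b σ))
          (⇔.sym (leaf⇔childless T b tree bounding σ))
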